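{- Let $G$ be a graph that is the join of finitely many cycles $C_m$ ($m\ge 3$) and crowns $C_m\odot K_1$ ($m\ge 3$), joined with at most one further graph which is a path, a comb, a triangular snake, or a quadrilateral snake. Then $G$ is a geometric mean graph.
   Context: In this paper the join $G_1+G_2$ of two graphs with disjoint vertex sets is their union (vertex set $V(G_1)\cup V(G_2)$, edge set $E(G_1)\cup E(G_2)$; no edges are added between them), so $G$ is the vertex-disjoint union of the listed components. The corona $G_1\odot G_2$ (with $G_1$ having $p$ vertices) is obtained from one copy of $G_1$ and $p$ copies of $G_2$ by joining the $i$-th vertex of $G_1$ to every vertex of the $i$-th copy of $G_2$; a crown is $C_m\odot K_1$ and a comb is $P_m\odot K_1$, where $P_m$, $C_m$ are the path and cycle on $m$ vertices. For a path $u_1\dots u_n$, the triangular snake $T_n$ adds for each $1\le i\le n-1$ a new vertex $v_i$ adjacent to $u_i$ and $u_{i+1}$; the quadrilateral snake $Q_n$ adds for each $1\le i\le n-1$ new vertices $v_i,w_i$ with edges $u_iv_i, v_iw_i, w_iu_{i+1}$. A graph $G$ with $p$ vertices and $q$ edges is a geometric mean graph if there is an injection $\psi: V(G)\to\{1,2,\dots,q+1\}$ such that, when each edge $uv$ is assigned one of the labels $\lfloor\sqrt{\psi(u)\psi(v)}\rfloor$ or $\lceil\sqrt{\psi(u)\psi(v)}\rceil$ (chosen per edge), the resulting set of edge labels is exactly $\{1,\dots,q\}$. -}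

module Defs where

open import Data.Nat using (ℕ; zero; suc; _+_; _*_; _≤_)
open import Data.Fin using (Fin; zero; suc; inject₁; fromℕ; _↑ˡ_; _↑ʳ_; splitAt)
open import Data.Product using (_×_; _,_; ∃)
open import Data.Sum using (inj₁; inj₂)
open import Data.List using (List; foldr; map)
open import Data.Maybe using (Maybe; just; nothing)
open import Relation.Binary.PropositionalEquality using (_≡_)
open import Function.Definitions using (Injective)
open import Data.Unit using (⊤)

record Graph : Set where
  constructor mkGraph
  field
    p    : ℕ
    q    : ℕ
    edge : Fin q → Fin p × Fin p
open Graph public

emptyGraph : Graph
emptyGraph = mkGraph 0 0 (λ ())

-- The paper's "join" G₁ + G₂: vertex-disjoint union (no edges added).
_⊕_ : Graph → Graph → Graph
G ⊕ H = mkGraph (p G + p H) (q G + q H) e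
  where
  e : Fin (q G + q H) → Fin (p G + p H) × Fin (p G + p H)
  e i with splitAt (q G) i
  ... | inj₁ j with edge G j
  ...   | (u , v) = (u ↑ˡ p H , v ↑ˡ p H)
  e i | inj₂ j with edge H j
  ...   | (u , v) = (p G ↑ʳ u , p G ↑ʳ v)

path : ℕ → Graph
path zero    = emptyGraph
path (suc k) = mkGraph (suc k) k (λ i → (inject₁ i , suc i))

cycle : ℕ → Graph
cycle zero    = emptyGraph
cycle (suc k) = mkGraph (suc k) (k + 1) e
  where
  e : Fin (k + 1) → Fin (suc k) × Fin (suc k)
  e i with splitAt k i
  ... | inj₁ j = (inject₁ j , suc j)
  ... | inj₂ _ = (fromℕ k , zero)

corona₁ : Graph → Graph
corona₁ G = mkGraph (p G + p G) (q G + p G) e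
  where
  e : Fin (q G + p G) → Fin (p G + p G) × Fin (p G + p G)
  e i with splitAt (q G) i
  ... | inj₁ j with edge G j
  ...   | (u , v) = (u ↑ˡ p G , v ↑ˡ p G)
  e i | inj₂ j = (j ↑ˡ p G , p G ↑ʳ j)

crown : ℕ → Graph
crown m = corona₁ (cycle m)

comb : ℕ → Graph
comb m = corona₁ (path m)

triSnake : ℕ → Graph
triSnake zero    = emptyGraph
triSnake (suc k) = mkGraph (suc k + k) (k + (k + k)) e
  where
  U : Fin (suc k) → Fin (suc k + k)
  U u = u ↑ˡ k
  V : Fin k → Fin (suc k + k)
  V v = suc k ↑ʳ v
  e : Fin (k + (k + k)) → Fin (suc k + k) × Fin (suc k + k)
  e i with splitAt k i
  ... | inj₁ j = (U (inject₁ j) , U (suc j))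
  ... | inj₂ j with splitAt k j
  ...   | inj₁ l = (U (inject₁ l) , V l)
  ...   | inj₂ l = (V l , U (suc l))

quadSnake : ℕ → Graph
quadSnake zero    = emptyGraph
quadSnake (suc k) = mkGraph (suc k + (k + k)) (k + (k + (k + k))) e
  where
  U : Fin (suc k) → Fin (suc k + (k + k))
  U u = u ↑ˡ (k + k)
  V : Fin k → Fin (suc k + (k + k))
  V v = suc k ↑ʳ (v ↑ˡ k)
  W : Fin k → Fin (suc k + (k + k))
  W w = suc k ↑ʳ (k ↑ʳ w)
  e : Fin (k + (k + (k + k))) → Fin (suc k + (k + k)) × Fin (suc k + (k + k))
  e i with splitAt k i
  ... | inj₁ j = (U (inject₁ j) , U (suc j))
  ... | inj₂ j with splitAt k j
  ...   | inj₁ l = (U (inject₁ l) , V l)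
  ...   | inj₂ l with splitAt k l
  ...     | inj₁ r = (V r , W r)
  ...     | inj₂ r = (W r , U (suc r))

IsFloorSqrt : ℕ → ℕ → Set
IsFloorSqrt x r = r * r ≤ x × (∀ s → s * s ≤ x → s ≤ r)

IsCeilSqrt : ℕ → ℕ → Set
IsCeilSqrt x r = x ≤ r * r × (∀ s → x ≤ s * s → r ≤ s)

data FloorOrCeilSqrt (x r : ℕ) : Set where
  isFloor : IsFloorSqrt x r → FloorOrCeilSqrt x r
  isCeil  : IsCeilSqrt x r → FloorOrCeilSqrt x r

record GeometricMeanLabeling (G : Graph) : Set where
  field
    ψ       : Fin (p G) → ℕ
    ψ-inj   : Injective _≡_ _≡_ ψ
    ψ-range : ∀ v → 1 ≤ ψ v × ψ v ≤ suc (q G)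
    f       : Fin (q G) → ℕ
    f-sqrt  : ∀ i → let (u , v) = edge G i in FloorOrCeilSqrt (ψ u * ψ v) (f i)
    f-range : ∀ i → 1 ≤ f i × f i ≤ q G
    f-onto  : ∀ l → 1 ≤ l → l ≤ q G → ∃ λ i → f i ≡ l

IsGeometricMean : Graph → Set
IsGeometricMean G = GeometricMeanLabeling G

data Base : Set where
  cycleB : ℕ → Base
  crownB : ℕ → Base

baseSize : Base → ℕ
baseSize (cycleB m) = m
baseSize (crownB m) = m

baseGraph : Base → Graph
baseGraph (cycleB m) = cycle m
baseGraph (crownB m) = crown m

data Extra : Set where
  pathE combE triE quadE : ℕ → Extra

-- Side conditions on the extra component (n = number of path vertices).
ExtraOK : Extra → Set
ExtraOK (pathE n) = 1 ≤ n
ExtraOK (combE n) = 1 ≤ n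
ExtraOK (triE n)  = 2 ≤ n
ExtraOK (quadE n) = 2 ≤ n

extraGraph : Extra → Graph
extraGraph (pathE n) = path n
extraGraph (combE n) = comb n
extraGraph (triE n)  = triSnake n
extraGraph (quadE n) = quadSnake n

MaybeExtraOK : Maybe Extra → Set
MaybeExtraOK nothing  = ⊤
MaybeExtraOK (just e) = ExtraOK e

maybeExtraGraph : Maybe Extra → Graph
maybeExtraGraph nothing  = emptyGraph
maybeExtraGraph (just e) = extraGraph e

assemble : List Base → Maybe Extra → Graph
assemble bs me = foldr _⊕_ (maybeExtraGraph me) (map baseGraph bs)

-- We label components one after another with consecutive blocks of labels: a
-- labeling with offset s of a graph with q edges uses vertex labels in (s, q + s]
-- (in (s, q + s + 1] for the last component, which may use one spare label) and
-- edge labels filling exactly (s, q + s].  Such labelings of B and of R with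
-- offset q_B + s glue to one of B + R with offset s (module DisjointUnion).
--
-- Edge labels are assigned through tags:
-- the edge tagged t gets t + s + 1, which must be ⌊√·⌋ or ⌈√·⌉ of the product of
-- its end labels; only four product shapes occur, m(m+1), m(m+2), m(m+3), m(m+4).
-- Paths and snakes label their vertices in residue classes so that the tags
-- run through [0, q).  For cycles and crowns all edges but the closing one have
-- products strictly between consecutive squares, so they may take either root;
-- choosing floors below ⌊√·⌋ of the closing edge and ceilings above it leaves
-- exactly that slot for the closing edge (cycleTag).

module Submission where

open import Defs
open import Data.Nat using (_≤_)
open import Data.List using (List)
open import Data.List.Relation.Unary.All using (All)
open import Data.Maybe using (Maybe)

open import Data.Nat using (ℕ; zero; suc; _+_; _*_; _∸_; _<_; z≤n; s≤s; s≤s⁻¹; _<?_; NonZero)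
open import Data.Nat.Properties
open import Data.Nat.DivMod using (_%_; _/_; m≡m%n+[m/n]*n; m%n<n; m<n*o⇒m/o<n; [m+kn]%n≡m%n; m<n⇒m%n≡m)
open import Data.Nat.Tactic.RingSolver using (solve-∀)
open import Data.Fin using (Fin; zero; suc; toℕ; _↑ˡ_; _↑ʳ_; splitAt; inject₁; fromℕ; fromℕ<)
open import Data.Fin.Properties using (splitAt-↑ˡ; splitAt-↑ʳ; splitAt⁻¹-↑ˡ; splitAt⁻¹-↑ʳ; toℕ-injective; toℕ<n; toℕ-fromℕ; toℕ-fromℕ<; toℕ-inject₁)
open import Data.Product using (_×_; _,_; ∃; ∃₂; proj₁; proj₂)
open import Data.Sum using (_⊎_; inj₁; inj₂; [_,_]′)
open import Data.Maybe using (just; nothing)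
open import Data.List using ([]; _∷_)
open import Data.List.Relation.Unary.All using ([]; _∷_)
open import Data.Empty using (⊥-elim)
open import Relation.Nullary using (yes; no)
open import Relation.Binary.PropositionalEquality
open import Relation.Binary.Definitions using (tri<; tri≈; tri>)
open import Function.Definitions using (Injective)
open import Function using (_∘_)

-- Square roots

floorSqrt-intro : ∀ {x r} → r * r ≤ x → x < suc r * suc r → IsFloorSqrt x r
floorSqrt-intro {x} {r} r²≤x x<[r+1]² = r²≤x , maximal
  where
  maximal : ∀ s → s * s ≤ x → s ≤ r
  maximal s s²≤x with s ≤? r
  ... | yes s≤r = s≤r
  ... | no s≰r = ⊥-elim (<⇒≱ x<[r+1]² (≤-trans (*-mono-≤ (≰⇒> s≰r) (≰⇒> s≰r)) s²≤x))

ceilSqrt-intro : ∀ {x r} → r * r < x → x ≤ suc r * suc r → IsCeilSqrt x (suc r)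
ceilSqrt-intro {x} {r} r²<x x≤[r+1]² = x≤[r+1]² , minimal
  where
  minimal : ∀ s → x ≤ s * s → suc r ≤ s
  minimal s x≤s² with suc r ≤? s
  ... | yes r<s = r<s
  ... | no r≮s = ⊥-elim (<⇒≱ r²<x (≤-trans x≤s² (*-mono-≤ (≮⇒≥ r≮s) (≮⇒≥ r≮s))))

StrictlyBetweenSquares : ℕ → ℕ → Set
StrictlyBetweenSquares m x = m * m < x × x < suc m * suc m

between⇒floor : ∀ {m x} → StrictlyBetweenSquares m x → FloorOrCeilSqrt x m
between⇒floor (m²<x , x<[m+1]²) = isFloor (floorSqrt-intro (<⇒≤ m²<x) x<[m+1]²)

between⇒ceil : ∀ {m x} → StrictlyBetweenSquares m x → FloorOrCeilSqrt x (suc m)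
between⇒ceil (m²<x , x<[m+1]²) = isCeil (ceilSqrt-intro m²<x (<⇒≤ x<[m+1]²))

between-intro : ∀ {m x} a b → x ≡ m * m + suc a → suc m * suc m ≡ x + suc b →
                StrictlyBetweenSquares m x
between-intro {m} {x} a b x≡ [m+1]²≡ =
  subst (m * m <_) (sym x≡) (m<m+n (m * m) (s≤s z≤n)) ,
  subst (x <_) (sym [m+1]²≡) (m<m+n x (s≤s z≤n))

-- The four kinds of edge products met in the labelings below, for m = y + 1 ≥ 1.

between-m[m+1] : ∀ y → StrictlyBetweenSquares (suc y) (suc y * (1 + suc y))
between-m[m+1] y = between-intro y (suc y) (gap₁ y) (gap₂ y)
  where
  gap₁ : ∀ y → suc y * (1 + suc y) ≡ suc y * suc y + suc y
  gap₁ = solve-∀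
  gap₂ : ∀ y → suc (suc y) * suc (suc y) ≡ suc y * (1 + suc y) + suc (suc y)
  gap₂ = solve-∀

-- m(m+2) = (m+1)² - 1 lies strictly between m² and (m+1)².
between-m[m+2] : ∀ y → StrictlyBetweenSquares (suc y) (suc y * (2 + suc y))
between-m[m+2] y = between-intro (y + y + 1) 0 (gap₁ y) (gap₂ y)
  where
  gap₁ : ∀ y → suc y * (2 + suc y) ≡ suc y * suc y + suc (y + y + 1)
  gap₁ = solve-∀
  gap₂ : ∀ y → suc (suc y) * suc (suc y) ≡ suc y * (2 + suc y) + 1
  gap₂ = solve-∀

-- m(m+4) = (m+2)² - 4 lies strictly between (m+1)² and (m+2)².
between-m[m+4] : ∀ y → StrictlyBetweenSquares (2 + y) (suc y * (4 + suc y))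
between-m[m+4] y = between-intro {m = 2 + y} (y + y) 3 (gap₁ y) (gap₂ y)
  where
  gap₁ : ∀ y → suc y * (4 + suc y) ≡ (2 + y) * (2 + y) + suc (y + y)
  gap₁ = solve-∀
  gap₂ : ∀ y → (3 + y) * (3 + y) ≡ suc y * (4 + suc y) + 4
  gap₂ = solve-∀

-- m(m+3) = (m+1)² + (m-1) has floor square root m+1.
floor-m[m+3] : ∀ y → FloorOrCeilSqrt (suc y * (3 + suc y)) (2 + y)
floor-m[m+3] y = isFloor (floorSqrt-intro
  (subst ((2 + y) * (2 + y) ≤_) (sym (gap₁ y)) (m≤m+n _ y))
  (subst (suc y * (3 + suc y) <_) (sym (gap₂ y)) (m<m+n _ (s≤s z≤n))))
  where
  gap₁ : ∀ y → suc y * (3 + suc y) ≡ (2 + y) * (2 + y) + y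
  gap₁ = solve-∀
  gap₂ : ∀ y → (3 + y) * (3 + y) ≡ suc y * (3 + suc y) + (5 + y)
  gap₂ = solve-∀

integerSqrt : ∀ x → ∃ λ c → c * c ≤ x × x < suc c * suc c
integerSqrt zero = 0 , z≤n , s≤s z≤n
integerSqrt (suc x) with integerSqrt x
... | c , c²≤x , x<[c+1]² with suc x <? suc c * suc c
...   | yes x+1<[c+1]² = c , m≤n⇒m≤1+n c²≤x , x+1<[c+1]²
...   | no x+1≮[c+1]² = suc c , ≮⇒≥ x+1≮[c+1]² ,
                        ≤-<-trans x<[c+1]² (*-mono-< (n<1+n (suc c)) (n<1+n (suc c)))

above-offset : ∀ {s l} → s < l → l ≡ suc ((l ∸ suc s) + s)
above-offset {s} {l} s<l = trans (sym (m∸n+n≡m s<l)) (+-suc (l ∸ suc s) s)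

floorSqrt-within : ∀ s N {x} → suc s * suc s ≤ x → x < suc (N + s) * suc (N + s) →
                   ∃ λ τ → τ < N × IsFloorSqrt x (suc (τ + s))
floorSqrt-within s N {x} lower upper with integerSqrt x
... | c , c²≤x , x<[c+1]² = c ∸ suc s , τ<N , subst (IsFloorSqrt x) c≡τ+s+1 floor
  where
  floor : IsFloorSqrt x c
  floor = floorSqrt-intro c²≤x x<[c+1]²
  c≡τ+s+1 : c ≡ suc ((c ∸ suc s) + s)
  c≡τ+s+1 = above-offset (proj₂ floor (suc s) lower)
  c<N+s+1 : c < suc (N + s)
  c<N+s+1 with c <? suc (N + s)
  ... | yes lt = lt
  ... | no ≮ = ⊥-elim (<⇒≱ upper (≤-trans (*-mono-≤ (≮⇒≥ ≮) (≮⇒≥ ≮)) c²≤x))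
  τ<N : c ∸ suc s < N
  τ<N = +-cancelʳ-< s _ N (s≤s⁻¹ (subst (_< suc (N + s)) c≡τ+s+1 c<N+s+1))

-- The product of the label N + s + 1 with a smaller label a > s has floor square
-- root τ + s + 1 for some τ < N.  This is the closing edge of a cycle.
closing-floor : ∀ s N {a} → s < a → a < suc (N + s) →
                ∃ λ τ → τ < N × IsFloorSqrt (suc (N + s) * a) (suc (τ + s))
closing-floor s N s<a a<top =
  floorSqrt-within s N (*-mono-≤ (<-trans s<a a<top) s<a) (*-monoʳ-< (suc (N + s)) a<top)

-- Offset labelings
--
-- A labeling of G with offset s and slack e uses distinct vertex labels in
-- (s, e + q + s] and edge labels filling exactly (s, q + s], where q = |E(G)|.
-- A geometric mean labeling is one with offset 0 and slack 1.

product : (G : Graph) → (Fin (p G) → ℕ) → Fin (q G) → ℕ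
product G ψ i = ψ (proj₁ (edge G i)) * ψ (proj₂ (edge G i))

record EdgeLabelling (G : Graph) (ψ : Fin (p G) → ℕ) (s : ℕ) : Set where
  field
    f      : Fin (q G) → ℕ
    f-sqrt : ∀ i → FloorOrCeilSqrt (product G ψ i) (f i)
    f-lo   : ∀ i → s < f i
    f-hi   : ∀ i → f i ≤ q G + s
    f-onto : ∀ l → s < l → l ≤ q G + s → ∃ λ i → f i ≡ l

record Labelling (G : Graph) (s e : ℕ) : Set where
  field
    ψ      : Fin (p G) → ℕ
    ψ-inj  : Injective _≡_ _≡_ ψ
    ψ-lo   : ∀ v → s < ψ v
    ψ-hi   : ∀ v → ψ v ≤ e + q G + s
    edges  : EdgeLabelling G ψ s

toGeometricMean : ∀ {G} → Labelling G 0 1 → IsGeometricMean G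
toGeometricMean {G} L = record
  { ψ = ψ ; ψ-inj = ψ-inj ; ψ-range = λ v → ψ-lo v , ≤-trans (ψ-hi v) (≤-reflexive (+-identityʳ _))
  ; f = f ; f-sqrt = f-sqrt ; f-range = λ i → f-lo i , ≤-trans (f-hi i) (≤-reflexive (+-identityʳ _))
  ; f-onto = λ l 1≤l l≤q → f-onto l 1≤l (≤-trans l≤q (≤-reflexive (sym (+-identityʳ _)))) }
  where open Labelling L ; open EdgeLabelling edges

emptyLabelling : ∀ s e → Labelling emptyGraph s e
emptyLabelling s e = record
  { ψ = λ () ; ψ-inj = λ { {()} } ; ψ-lo = λ () ; ψ-hi = λ ()
  ; edges = record { f = λ () ; f-sqrt = λ () ; f-lo = λ () ; f-hi = λ ()
                   ; f-onto = λ l s<l l≤s → ⊥-elim (<⇒≱ s<l l≤s) } }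

copair : ∀ {m n} {A : Set} → (Fin m → A) → (Fin n → A) → Fin (m + n) → A
copair {m} g h w = [ g , h ]′ (splitAt m w)

copair-↑ˡ : ∀ {m n} {A : Set} (g : Fin m → A) (h : Fin n → A) u → copair g h (u ↑ˡ n) ≡ g u
copair-↑ˡ {m} {n} g h u = cong [ g , h ]′ (splitAt-↑ˡ m u n)

copair-↑ʳ : ∀ {m n} {A : Set} (g : Fin m → A) (h : Fin n → A) u → copair g h (m ↑ʳ u) ≡ h u
copair-↑ʳ {m} {n} g h u = cong [ g , h ]′ (splitAt-↑ʳ m n u)

copair-all : ∀ {m n} {A : Set} (P : A → Set) (g : Fin m → A) (h : Fin n → A) →
             (∀ u → P (g u)) → (∀ u → P (h u)) → ∀ w → P (copair g h w)
copair-all {m} P g h Pg Ph w with splitAt m w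
... | inj₁ u = Pg u
... | inj₂ u = Ph u

copair-injective : ∀ {m n} {A : Set} (g : Fin m → A) (h : Fin n → A) →
                   Injective _≡_ _≡_ g → Injective _≡_ _≡_ h → (∀ a b → g a ≢ h b) →
                   Injective _≡_ _≡_ (copair g h)
copair-injective {m} {n} g h g-inj h-inj disjoint {u} {v} eq
  with splitAt m u in eu | splitAt m v in ev
... | inj₁ a | inj₁ b = trans (sym (splitAt⁻¹-↑ˡ eu)) (trans (cong (_↑ˡ n) (g-inj eq)) (splitAt⁻¹-↑ˡ ev))
... | inj₂ a | inj₂ b = trans (sym (splitAt⁻¹-↑ʳ eu)) (trans (cong (m ↑ʳ_) (h-inj eq)) (splitAt⁻¹-↑ʳ ev))
... | inj₁ a | inj₂ b = ⊥-elim (disjoint a b eq)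
... | inj₂ a | inj₁ b = ⊥-elim (disjoint b a (sym eq))

-- B's vertex labels stay below every vertex label of R, so the union is injective,
-- and the edge-label intervals (s, q_B + s] and (q_B + s, q_R + q_B + s] tile
-- (s, q_B + q_R + s].
module DisjointUnion {B R : Graph} {s e : ℕ}
                     (LB : Labelling B s 0) (LR : Labelling R (q B + s) e) where
  private
    module LB = Labelling LB
    module LR = Labelling LR
    module EB = EdgeLabelling LB.edges
    module ER = EdgeLabelling LR.edges

  -- Bounds of R, measured from q_B + s, are bounds of the union measured from s.
  rebase : ∀ c → c + q R + (q B + s) ≡ c + (q B + q R) + s
  rebase c = rebase′ c (q B) (q R) s
    where
    rebase′ : ∀ c a b s → c + b + (a + s) ≡ c + (a + b) + s
    rebase′ = solve-∀

  ψ : Fin (p B + p R) → ℕ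
  ψ = copair LB.ψ LR.ψ

  ψ-inj : Injective _≡_ _≡_ ψ
  ψ-inj = copair-injective LB.ψ LR.ψ LB.ψ-inj LR.ψ-inj separated
    where
    separated : ∀ a b → LB.ψ a ≢ LR.ψ b
    separated a b eq = <⇒≱ (≤-<-trans (LB.ψ-hi a) (LR.ψ-lo b)) (≤-reflexive (sym eq))

  ψ-lo : ∀ v → s < ψ v
  ψ-lo = copair-all (s <_) LB.ψ LR.ψ LB.ψ-lo (λ b → ≤-<-trans (m≤n+m s (q B)) (LR.ψ-lo b))

  ψ-hi : ∀ v → ψ v ≤ e + (q B + q R) + s
  ψ-hi = copair-all (_≤ e + (q B + q R) + s) LB.ψ LR.ψ below
                    (λ b → ≤-trans (LR.ψ-hi b) (≤-reflexive (rebase e)))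
    where
    below : ∀ a → LB.ψ a ≤ e + (q B + q R) + s
    below a = ≤-trans (LB.ψ-hi a) (+-monoˡ-≤ s (≤-trans (m≤m+n (q B) (q R)) (m≤n+m _ e)))

  f : Fin (q B + q R) → ℕ
  f = copair EB.f ER.f

  f-sqrt : ∀ i → FloorOrCeilSqrt (product (B ⊕ R) ψ i) (f i)
  f-sqrt i with splitAt (q B) i
  ... | inj₁ j with edge B j | EB.f-sqrt j
  ...   | (u , v) | valid rewrite copair-↑ˡ LB.ψ LR.ψ u | copair-↑ˡ LB.ψ LR.ψ v = valid
  f-sqrt i | inj₂ j with edge R j | ER.f-sqrt j
  ...   | (u , v) | valid rewrite copair-↑ʳ LB.ψ LR.ψ u | copair-↑ʳ LB.ψ LR.ψ v = valid

  f-lo : ∀ i → s < f i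
  f-lo = copair-all (s <_) EB.f ER.f EB.f-lo (λ j → ≤-<-trans (m≤n+m s (q B)) (ER.f-lo j))

  f-hi : ∀ i → f i ≤ (q B + q R) + s
  f-hi = copair-all (_≤ (q B + q R) + s) EB.f ER.f (below-edge ∘ EB.f-hi)
                    (λ j → ≤-trans (ER.f-hi j) (≤-reflexive (rebase 0)))
    where
    below-edge : ∀ {l} → l ≤ q B + s → l ≤ (q B + q R) + s
    below-edge l≤ = ≤-trans l≤ (+-monoˡ-≤ s (m≤m+n (q B) (q R)))

  f-onto : ∀ l → s < l → l ≤ (q B + q R) + s → ∃ λ i → f i ≡ l
  f-onto l s<l l≤ with l ≤? q B + s
  ... | yes l≤qB+s with EB.f-onto l s<l l≤qB+s
  ...   | j , fj≡l = j ↑ˡ q R , trans (copair-↑ˡ EB.f ER.f j) fj≡l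
  f-onto l s<l l≤ | no l≰qB+s with ER.f-onto l (≰⇒> l≰qB+s) (≤-trans l≤ (≤-reflexive (sym (rebase 0))))
  ...   | j , fj≡l = q B ↑ʳ j , trans (copair-↑ʳ EB.f ER.f j) fj≡l

  labelling : Labelling (B ⊕ R) s e
  labelling = record
    { ψ = ψ ; ψ-inj = ψ-inj ; ψ-lo = ψ-lo ; ψ-hi = ψ-hi
    ; edges = record { f = f ; f-sqrt = f-sqrt ; f-lo = f-lo ; f-hi = f-hi ; f-onto = f-onto } }

-- An edge with product x tagged t < N is to receive the label t + s + 1, which must be
-- an admissible square-root label of x.
record TaggedEdge (s N x : ℕ) : Set where
  constructor tagged
  field
    tag   : ℕ
    tag<N : tag < N
    valid : FloorOrCeilSqrt x (suc (tag + s))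

edgeLabelling : ∀ {G} (ψ : Fin (p G) → ℕ) s N → q G ≡ N →
                (T : ∀ i → TaggedEdge s N (product G ψ i)) →
                (∀ t → t < N → ∃ λ i → TaggedEdge.tag (T i) ≡ t) →
                EdgeLabelling G ψ s
edgeLabelling {G} ψ s N refl T onto = record
  { f = λ i → suc (tag (T i) + s)
  ; f-sqrt = λ i → valid (T i)
  ; f-lo = λ i → s≤s (m≤n+m s _)
  ; f-hi = λ i → +-monoˡ-≤ s (tag<N (T i))
  ; f-onto = f-onto }
  where
  open TaggedEdge
  f-onto : ∀ l → s < l → l ≤ N + s → ∃ λ i → suc (tag (T i) + s) ≡ l
  f-onto l s<l l≤N+s with onto (l ∸ suc s) t<N
    where
    t<N : l ∸ suc s < N
    t<N = +-cancelʳ-≤ s _ N (subst (_≤ N + s) (above-offset s<l) l≤N+s)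
  ... | i , tag≡t = i , trans (cong (λ t → suc (t + s)) tag≡t) (sym (above-offset s<l))

-- Cycles
data CycleEdge (s N τ x : ℕ) : Set where
  chainEdge   : (t : ℕ) → t < N → StrictlyBetweenSquares (suc (t + s)) x → CycleEdge s N τ x
  closingEdge : IsFloorSqrt x (suc (τ + s)) → CycleEdge s N τ x

chainIndex : ∀ {s N τ x} → CycleEdge s N τ x → Maybe ℕ
chainIndex (chainEdge t _ _) = just t
chainIndex (closingEdge _)   = nothing

-- Chain edges below the closing label keep their floor t + s + 1, those from τ on
-- move up to their ceiling t + s + 2; this frees the label τ + s + 1 for the
-- closing edge, and the tags fill [0, N].
cycleTag : ∀ {s N τ x} → τ < N → CycleEdge s N τ x → TaggedEdge s (suc N) x
cycleTag {τ = τ} τ<N (chainEdge t t<N between) with t <? τ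
... | yes _ = tagged t (m≤n⇒m≤1+n t<N) (between⇒floor between)
... | no _  = tagged (suc t) (s≤s t<N) (between⇒ceil between)
cycleTag {τ = τ} τ<N (closingEdge floor) = tagged τ (m≤n⇒m≤1+n τ<N) (isFloor floor)

module _ {s N τ x : ℕ} (τ<N : τ < N) where
  open TaggedEdge

  tag-below : ∀ {t} (E : CycleEdge s N τ x) → chainIndex E ≡ just t → t < τ → tag (cycleTag τ<N E) ≡ t
  tag-below (chainEdge t _ _) refl t<τ with t <? τ
  ... | yes _  = refl
  ... | no t≮τ = ⊥-elim (t≮τ t<τ)

  tag-above : ∀ {t} (E : CycleEdge s N τ x) → chainIndex E ≡ just t → τ ≤ t → tag (cycleTag τ<N E) ≡ suc t
  tag-above (chainEdge t _ _) refl τ≤t with t <? τ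
  ... | yes t<τ = ⊥-elim (<⇒≱ t<τ τ≤t)
  ... | no _    = refl

  tag-closing : ∀ (E : CycleEdge s N τ x) → chainIndex E ≡ nothing → tag (cycleTag τ<N E) ≡ τ
  tag-closing (closingEdge _) refl = refl

cycleTags-onto : ∀ {s N τ n} {x : Fin n → ℕ} (τ<N : τ < N) (E : ∀ i → CycleEdge s N τ (x i)) →
                 (∀ t → t < N → ∃ λ i → chainIndex (E i) ≡ just t) →
                 (∃ λ i → chainIndex (E i) ≡ nothing) →
                 ∀ u → u < suc N → ∃ λ i → TaggedEdge.tag (cycleTag τ<N (E i)) ≡ u
cycleTags-onto {τ = τ} τ<N E chain closing u u≤N with <-cmp u τ
... | tri< u<τ _ _ with chain u (<-trans u<τ τ<N)
...   | i , index≡u = i , tag-below τ<N (E i) index≡u u<τ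
cycleTags-onto τ<N E chain (i , closes) u u≤N | tri≈ _ refl _ = i , tag-closing τ<N (E i) closes
cycleTags-onto {τ = τ} τ<N E chain closing (suc t) (s≤s t<N) | tri> _ _ (s≤s τ≤t) with chain t t<N
... | i , index≡t = i , tag-above τ<N (E i) index≡t τ≤t

cycleEdgeLabelling : ∀ {G} (ψ : Fin (p G) → ℕ) s N {τ} → q G ≡ suc N → (τ<N : τ < N) →
                     (E : ∀ i → CycleEdge s N τ (product G ψ i)) →
                     (∀ t → t < N → ∃ λ i → chainIndex (E i) ≡ just t) →
                     (∃ λ i → chainIndex (E i) ≡ nothing) →
                     EdgeLabelling G ψ s
cycleEdgeLabelling ψ s N q≡N+1 τ<N E chain closing =
  edgeLabelling ψ s (suc N) q≡N+1 (λ i → cycleTag τ<N (E i)) (cycleTags-onto τ<N E chain closing)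

-- Residue classes
--
-- The snakes, combs and crowns are labeled by residue classes modulo d: the j-th
-- vertex of class r < d gets the label r + j·d + s + 1.
classLabel : (d s r j : ℕ) → ℕ
classLabel d s r j = suc (r + (j * d + s))

classLabel-injective : ∀ d .{{_ : NonZero d}} s {r r′ a b} → r < d → r′ < d →
                       classLabel d s r a ≡ classLabel d s r′ b → r ≡ r′ × a ≡ b
classLabel-injective d s {r} {r′} {a} {b} r<d r′<d eq = r≡r′ , a≡b
  where
  open ≡-Reasoning
  residues : r + a * d ≡ r′ + b * d
  residues = +-cancelʳ-≡ s _ _ (begin
    r + a * d + s    ≡⟨ +-assoc r (a * d) s ⟩
    r + (a * d + s)  ≡⟨ suc-injective eq ⟩
    r′ + (b * d + s) ≡⟨ +-assoc r′ (b * d) s ⟨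
    r′ + b * d + s   ∎)
  r≡r′ : r ≡ r′
  r≡r′ = begin
    r                  ≡⟨ m<n⇒m%n≡m r<d ⟨
    r % d              ≡⟨ [m+kn]%n≡m%n r a d ⟨
    (r + a * d) % d    ≡⟨ cong (_% d) residues ⟩
    (r′ + b * d) % d   ≡⟨ [m+kn]%n≡m%n r′ b d ⟩
    r′ % d             ≡⟨ m<n⇒m%n≡m r′<d ⟩
    r′                 ∎
  a≡b : a ≡ b
  a≡b = *-cancelʳ-≡ a b d (+-cancelˡ-≡ r′ _ _ (subst (λ z → z + a * d ≡ r′ + b * d) r≡r′ residues))

class-injective : ∀ d .{{_ : NonZero d}} s {r n} → r < d →
                  Injective _≡_ _≡_ (λ (j : Fin n) → classLabel d s r (toℕ j))
class-injective d s r<d {a} {b} eq = toℕ-injective (proj₂ (classLabel-injective d s {a = toℕ a} {toℕ b} r<d r<d eq))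

classes-disjoint : ∀ d .{{_ : NonZero d}} s {r r′ m n} → r < d → r′ < d → r ≢ r′ →
                   (a : Fin m) (b : Fin n) → classLabel d s r (toℕ a) ≢ classLabel d s r′ (toℕ b)
classes-disjoint d s r<d r′<d r≢r′ a b eq = r≢r′ (proj₁ (classLabel-injective d s {a = toℕ a} {toℕ b} r<d r′<d eq))

classLabel-lo : ∀ d s r j → s < classLabel d s r j
classLabel-lo d s r j = s≤s (≤-trans (m≤n+m s (j * d)) (m≤n+m _ r))

residue< : ∀ {d r j k} → r < d → j < k → r + j * d < k * d
residue< {d} {r} {j} {k} r<d j<k = <-≤-trans (+-monoˡ-< (j * d) r<d) (*-monoˡ-≤ d j<k)

classLabel-hi : ∀ d s r j {N} → r + j * d < N → classLabel d s r j ≤ N + s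
classLabel-hi d s r j {N} residue<N =
  subst (_≤ N + s) (cong suc (+-assoc r (j * d) s)) (+-monoˡ-≤ s residue<N)

residue-decomposition : ∀ d .{{_ : NonZero d}} {k t} → t < k * d →
                        ∃₂ λ r j → r < d × j < k × t ≡ r + j * d
residue-decomposition d {k} {t} t<kd = t % d , t / d , m%n<n t d , m<n*o⇒m/o<n t<kd , m≡m%n+[m/n]*n t d

-- Paths and cycles
--
-- The vertex u_i of a path or cycle on n vertices gets the label i + s + 1, so
-- consecutive vertices have labels m and m + 1, whose product m(m + 1) admits m.
module ConsecutiveLabels (n s : ℕ) where
  ψ : Fin n → ℕ
  ψ i = suc (toℕ i + s)

  ψ-inj : Injective _≡_ _≡_ ψ
  ψ-inj eq = toℕ-injective (+-cancelʳ-≡ s _ _ (suc-injective eq))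

  ψ-lo : ∀ i → s < ψ i
  ψ-lo i = s≤s (m≤n+m s (toℕ i))

  ψ-hi : ∀ i → ψ i ≤ n + s
  ψ-hi i = +-monoˡ-≤ s (toℕ<n i)

module PathLabelling (n s : ℕ) where
  open ConsecutiveLabels (suc n) s

  consecutive-product : ∀ (j : Fin n) → ψ (inject₁ j) * ψ (suc j) ≡ suc (toℕ j + s) * (1 + suc (toℕ j + s))
  consecutive-product j = cong (λ z → suc (z + s) * ψ (suc j)) (toℕ-inject₁ j)

  consecutive-between : ∀ (j : Fin n) → StrictlyBetweenSquares (suc (toℕ j + s)) (ψ (inject₁ j) * ψ (suc j))
  consecutive-between j = subst (StrictlyBetweenSquares _) (sym (consecutive-product j)) (between-m[m+1] _)

  tags : ∀ i → TaggedEdge s n (product (path (suc n)) ψ i)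
  tags i = tagged (toℕ i) (toℕ<n i) (between⇒floor (consecutive-between i))

  labelling : Labelling (path (suc n)) s 1
  labelling = record
    { ψ = ψ ; ψ-inj = ψ-inj ; ψ-lo = ψ-lo ; ψ-hi = ψ-hi
    ; edges = edgeLabelling ψ s n refl tags (λ t t<n → fromℕ< t<n , toℕ-fromℕ< t<n) }

module CycleLabelling (k s : ℕ) (1≤k : 1 ≤ k) where
  open ConsecutiveLabels (suc k) s
  open PathLabelling k s using (consecutive-between)

  closing : ∃ λ τ → τ < k × IsFloorSqrt (suc (k + s) * suc s) (suc (τ + s))
  closing = closing-floor s k (n<1+n s) (s≤s (+-monoˡ-≤ s 1≤k))

  closing-product : ψ (fromℕ k) * ψ zero ≡ suc (k + s) * suc s
  closing-product = cong (λ z → suc (z + s) * suc s) (toℕ-fromℕ k)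

  kind : ∀ i → CycleEdge s k (proj₁ closing) (product (cycle (suc k)) ψ i)
  kind i with splitAt k i
  ... | inj₁ j = chainEdge (toℕ j) (toℕ<n j) (consecutive-between j)
  ... | inj₂ _ = closingEdge (subst (λ x → IsFloorSqrt x (suc (proj₁ closing + s))) (sym closing-product) (proj₂ (proj₂ closing)))

  chain : ∀ t → t < k → ∃ λ i → chainIndex (kind i) ≡ just t
  chain t t<k = fromℕ< t<k ↑ˡ 1 , index
    where
    index : chainIndex (kind (fromℕ< t<k ↑ˡ 1)) ≡ just t
    index rewrite splitAt-↑ˡ k (fromℕ< t<k) 1 = cong just (toℕ-fromℕ< t<k)

  closes : ∃ λ i → chainIndex (kind i) ≡ nothing
  closes = k ↑ʳ zero , index
    where
    index : chainIndex (kind (k ↑ʳ zero)) ≡ nothing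
    index rewrite splitAt-↑ʳ k 1 zero = refl

  labelling : Labelling (cycle (suc k)) s 0
  labelling = record
    { ψ = ψ ; ψ-inj = ψ-inj ; ψ-lo = ψ-lo
    ; ψ-hi = λ i → subst (λ n → ψ i ≤ n + s) (+-comm 1 k) (ψ-hi i)
    ; edges = cycleEdgeLabelling ψ s k (+-comm k 1) (proj₁ (proj₂ closing)) kind chain closes }

-- Combs and crowns
--
-- In the corona of a path or cycle on k + 1 vertices, spine vertex u gets the odd
-- label 2u + s + 2 and its pendant the even label 2u + s + 1.  A pendant edge has
-- product m(m + 1) for its pendant label m, a spine edge has product m(m + 2) for
-- m = 2j + s + 2; both admit m.

parity-decomposition : ∀ {k t} → t < suc (k * 2) →
                       (∃ λ (u : Fin (suc k)) → toℕ u * 2 ≡ t) ⊎ (∃ λ (j : Fin k) → 1 + toℕ j * 2 ≡ t)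
parity-decomposition {k} {t} t≤2k with residue-decomposition 2 {suc k} (≤-trans t≤2k (n≤1+n _))
... | 0 , u , _ , u≤k , refl = inj₁ (fromℕ< u≤k , cong (_* 2) (toℕ-fromℕ< u≤k))
... | 1 , j , _ , _ , refl = inj₂ (fromℕ< j<k , cong (λ z → 1 + z * 2) (toℕ-fromℕ< j<k))
  where
  j<k : j < k
  j<k = *-cancelʳ-< 2 j k (s≤s⁻¹ t≤2k)
... | suc (suc _) , _ , s≤s (s≤s ()) , _

module CoronaLabels (k s : ℕ) where
  spine : Fin (suc k) → ℕ
  spine u = classLabel 2 s 1 (toℕ u)

  pendant : Fin (suc k) → ℕ
  pendant u = classLabel 2 s 0 (toℕ u)

  ψ : Fin (suc k + suc k) → ℕ
  ψ = copair spine pendant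

  ψ-inj : Injective _≡_ _≡_ ψ
  ψ-inj = copair-injective spine pendant (class-injective 2 s (s≤s (s≤s z≤n))) (class-injective 2 s (s≤s z≤n))
                           (classes-disjoint 2 s (s≤s (s≤s z≤n)) (s≤s z≤n) (λ ()))

  ψ-lo : ∀ w → s < ψ w
  ψ-lo = copair-all (s <_) spine pendant (λ u → classLabel-lo 2 s 1 (toℕ u)) (λ u → classLabel-lo 2 s 0 (toℕ u))

  ψ-hi : ∀ w → ψ w ≤ suc k * 2 + s
  ψ-hi = copair-all (_≤ suc k * 2 + s) spine pendant (λ u → classLabel-hi 2 s 1 (toℕ u) (residue< (s≤s (s≤s z≤n)) (toℕ<n u)))
                                                      (λ u → classLabel-hi 2 s 0 (toℕ u) (residue< (s≤s z≤n) (toℕ<n u)))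

  pendant-between : ∀ u → StrictlyBetweenSquares (pendant u) (ψ (u ↑ˡ suc k) * ψ (suc k ↑ʳ u))
  pendant-between u rewrite copair-↑ˡ spine pendant u | copair-↑ʳ spine pendant u
    = subst (StrictlyBetweenSquares _) (*-comm (pendant u) (spine u)) (between-m[m+1] (toℕ u * 2 + s))

  spine-between : ∀ (j : Fin k) → StrictlyBetweenSquares (suc (suc (toℕ j * 2 + s)))
                                    (ψ (inject₁ j ↑ˡ suc k) * ψ (suc j ↑ˡ suc k))
  spine-between j rewrite copair-↑ˡ spine pendant (inject₁ j) | copair-↑ˡ spine pendant (suc j)
                        | toℕ-inject₁ j = between-m[m+2] (suc (toℕ j * 2 + s))

module CombLabelling (k s : ℕ) where
  open CoronaLabels k s

  tags : ∀ i → TaggedEdge s (suc (k * 2)) (product (comb (suc k)) ψ i)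
  tags i with splitAt k i
  ... | inj₁ j = tagged (1 + toℕ j * 2) (m≤n⇒m≤1+n (residue< (s≤s (s≤s z≤n)) (toℕ<n j)))
                        (between⇒floor (spine-between j))
  ... | inj₂ u = tagged (toℕ u * 2) (s≤s (*-monoˡ-≤ 2 (s≤s⁻¹ (toℕ<n u))))
                        (between⇒floor (pendant-between u))

  onto : ∀ t → t < suc (k * 2) → ∃ λ i → TaggedEdge.tag (tags i) ≡ t
  onto t t≤2k with parity-decomposition t≤2k
  ... | inj₁ (u , 2u≡t) = k ↑ʳ u , pendant-tag
    where
    pendant-tag : TaggedEdge.tag (tags (k ↑ʳ u)) ≡ t
    pendant-tag rewrite splitAt-↑ʳ k (suc k) u = 2u≡t
  ... | inj₂ (j , 2j+1≡t) = j ↑ˡ suc k , spine-tag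
    where
    spine-tag : TaggedEdge.tag (tags (j ↑ˡ suc k)) ≡ t
    spine-tag rewrite splitAt-↑ˡ k j (suc k) = 2j+1≡t

  labelling : Labelling (comb (suc k)) s 1
  labelling = record
    { ψ = ψ ; ψ-inj = ψ-inj ; ψ-lo = ψ-lo
    ; ψ-hi = λ w → subst (λ n → ψ w ≤ n + s) (vertices k) (ψ-hi w)
    ; edges = edgeLabelling ψ s (suc (k * 2)) (edges k) tags onto }
    where
    vertices : ∀ k → suc k * 2 ≡ 1 + (k + suc k)
    vertices = solve-∀
    edges : ∀ k → k + suc k ≡ suc (k * 2)
    edges = solve-∀

module CrownLabelling (k s : ℕ) (1≤k : 1 ≤ k) where
  open CoronaLabels k s

  closing : ∃ λ τ → τ < suc (k * 2) × IsFloorSqrt (suc (suc (k * 2 + s)) * suc (suc s)) (suc (τ + s))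
  closing = closing-floor s (suc (k * 2)) (s≤s (n≤1+n s)) (s≤s (s≤s (+-monoˡ-≤ s (≤-trans 1≤k (m≤m*n k 2)))))

  closing-product : ψ (fromℕ k ↑ˡ suc k) * ψ (zero ↑ˡ suc k) ≡ suc (suc (k * 2 + s)) * suc (suc s)
  closing-product rewrite copair-↑ˡ spine pendant (fromℕ k) | copair-↑ˡ spine pendant zero | toℕ-fromℕ k = refl

  kind : ∀ i → CycleEdge s (suc (k * 2)) (proj₁ closing) (product (crown (suc k)) ψ i)
  kind i with splitAt (k + 1) i
  ... | inj₁ j with splitAt k j
  ...   | inj₁ j′ = chainEdge (1 + toℕ j′ * 2) (m≤n⇒m≤1+n (residue< (s≤s (s≤s z≤n)) (toℕ<n j′))) (spine-between j′)
  ...   | inj₂ _ = closingEdge (subst (λ x → IsFloorSqrt x (suc (proj₁ closing + s))) (sym closing-product)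
                                       (proj₂ (proj₂ closing)))
  kind i | inj₂ u = chainEdge (toℕ u * 2) (s≤s (*-monoˡ-≤ 2 (s≤s⁻¹ (toℕ<n u)))) (pendant-between u)

  chain : ∀ t → t < suc (k * 2) → ∃ λ i → chainIndex (kind i) ≡ just t
  chain t t≤2k with parity-decomposition t≤2k
  ... | inj₁ (u , 2u≡t) = (k + 1) ↑ʳ u , pendant-index
    where
    pendant-index : chainIndex (kind ((k + 1) ↑ʳ u)) ≡ just t
    pendant-index rewrite splitAt-↑ʳ (k + 1) (suc k) u = cong just 2u≡t
  ... | inj₂ (j , 2j+1≡t) = (j ↑ˡ 1) ↑ˡ suc k , spine-index
    where
    spine-index : chainIndex (kind ((j ↑ˡ 1) ↑ˡ suc k)) ≡ just t
    spine-index rewrite splitAt-↑ˡ (k + 1) (j ↑ˡ 1) (suc k) | splitAt-↑ˡ k j 1 = cong just 2j+1≡t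

  closes : ∃ λ i → chainIndex (kind i) ≡ nothing
  closes = (k ↑ʳ zero) ↑ˡ suc k , closing-index
    where
    closing-index : chainIndex (kind ((k ↑ʳ zero) ↑ˡ suc k)) ≡ nothing
    closing-index rewrite splitAt-↑ˡ (k + 1) (k ↑ʳ zero) (suc k) | splitAt-↑ʳ k 1 zero = refl

  labelling : Labelling (crown (suc k)) s 0
  labelling = record
    { ψ = ψ ; ψ-inj = ψ-inj ; ψ-lo = ψ-lo
    ; ψ-hi = λ w → subst (λ n → ψ w ≤ n + s) (vertices k) (ψ-hi w)
    ; edges = cycleEdgeLabelling ψ s (suc (k * 2)) (edges k) (proj₁ (proj₂ closing)) kind chain closes }
    where
    vertices : ∀ k → suc k * 2 ≡ (k + 1) + suc k
    vertices = solve-∀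
    edges : ∀ k → (k + 1) + suc k ≡ suc (suc (k * 2))
    edges = solve-∀

-- Triangular snakes
--
-- In T_{k+1}, path vertex u_j gets 3j + s + 1 and apex v_j gets 3j + s + 2.  With
-- m = 3j + s + 1 the triangle on u_j v_j u_{j+1} has products m(m + 3), m(m + 1)
-- and (m + 1)(m + 3), admitting m + 1, m and m + 2: the tags 3j + 1, 3j, 3j + 2.
module TriangularSnakeLabelling (k s : ℕ) where
  pathLabel : Fin (suc k) → ℕ
  pathLabel u = classLabel 3 s 0 (toℕ u)

  apexLabel : Fin k → ℕ
  apexLabel v = classLabel 3 s 1 (toℕ v)

  ψ : Fin (suc k + k) → ℕ
  ψ = copair pathLabel apexLabel

  ψ-inj : Injective _≡_ _≡_ ψ
  ψ-inj = copair-injective pathLabel apexLabel (class-injective 3 s (s≤s z≤n)) (class-injective 3 s (s≤s (s≤s z≤n)))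
                           (classes-disjoint 3 s (s≤s z≤n) (s≤s (s≤s z≤n)) (λ ()))

  ψ-lo : ∀ w → s < ψ w
  ψ-lo = copair-all (s <_) pathLabel apexLabel (λ u → classLabel-lo 3 s 0 (toℕ u)) (λ v → classLabel-lo 3 s 1 (toℕ v))

  ψ-hi : ∀ w → ψ w ≤ suc (k * 3) + s
  ψ-hi = copair-all (_≤ suc (k * 3) + s) pathLabel apexLabel
           (λ u → classLabel-hi 3 s 0 (toℕ u) (s≤s (*-monoˡ-≤ 3 (s≤s⁻¹ (toℕ<n u)))))
           (λ v → classLabel-hi 3 s 1 (toℕ v) (m≤n⇒m≤1+n (residue< (s≤s (s≤s z≤n)) (toℕ<n v))))

  ψU : ∀ u → ψ (u ↑ˡ k) ≡ pathLabel u
  ψU = copair-↑ˡ pathLabel apexLabel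

  ψV : ∀ v → ψ (suc k ↑ʳ v) ≡ apexLabel v
  ψV = copair-↑ʳ pathLabel apexLabel

  path-edge : ∀ (j : Fin k) → FloorOrCeilSqrt (ψ (inject₁ j ↑ˡ k) * ψ (suc j ↑ˡ k)) (suc ((1 + toℕ j * 3) + s))
  path-edge j rewrite ψU (inject₁ j) | ψU (suc j) | toℕ-inject₁ j = floor-m[m+3] (toℕ j * 3 + s)

  rising-edge : ∀ (j : Fin k) → FloorOrCeilSqrt (ψ (inject₁ j ↑ˡ k) * ψ (suc k ↑ʳ j)) (suc (toℕ j * 3 + s))
  rising-edge j rewrite ψU (inject₁ j) | ψV j | toℕ-inject₁ j = between⇒floor (between-m[m+1] (toℕ j * 3 + s))

  falling-edge : ∀ (j : Fin k) → FloorOrCeilSqrt (ψ (suc k ↑ʳ j) * ψ (suc j ↑ˡ k)) (suc ((2 + toℕ j * 3) + s))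
  falling-edge j rewrite ψV j | ψU (suc j) = between⇒ceil (between-m[m+2] (suc (toℕ j * 3 + s)))

  tags : ∀ i → TaggedEdge s (k * 3) (product (triSnake (suc k)) ψ i)
  tags i with splitAt k i
  ... | inj₁ j = tagged (1 + toℕ j * 3) (residue< (s≤s (s≤s z≤n)) (toℕ<n j)) (path-edge j)
  ... | inj₂ j with splitAt k j
  ...   | inj₁ l = tagged (toℕ l * 3) (residue< (s≤s z≤n) (toℕ<n l)) (rising-edge l)
  ...   | inj₂ l = tagged (2 + toℕ l * 3) (residue< (s≤s (s≤s (s≤s z≤n))) (toℕ<n l)) (falling-edge l)

  onto : ∀ t → t < k * 3 → ∃ λ i → TaggedEdge.tag (tags i) ≡ t
  onto t t<3k with residue-decomposition 3 {k} t<3k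
  ... | 0 , j , _ , j<k , refl = k ↑ʳ (fromℕ< j<k ↑ˡ k) , rising-tag
    where
    rising-tag : TaggedEdge.tag (tags (k ↑ʳ (fromℕ< j<k ↑ˡ k))) ≡ j * 3
    rising-tag rewrite splitAt-↑ʳ k (k + k) (fromℕ< j<k ↑ˡ k) | splitAt-↑ˡ k (fromℕ< j<k) k
      = cong (_* 3) (toℕ-fromℕ< j<k)
  ... | 1 , j , _ , j<k , refl = fromℕ< j<k ↑ˡ (k + k) , path-tag
    where
    path-tag : TaggedEdge.tag (tags (fromℕ< j<k ↑ˡ (k + k))) ≡ 1 + j * 3
    path-tag rewrite splitAt-↑ˡ k (fromℕ< j<k) (k + k) = cong (λ z → 1 + z * 3) (toℕ-fromℕ< j<k)
  ... | 2 , j , _ , j<k , refl = k ↑ʳ (k ↑ʳ fromℕ< j<k) , falling-tag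
    where
    falling-tag : TaggedEdge.tag (tags (k ↑ʳ (k ↑ʳ fromℕ< j<k))) ≡ 2 + j * 3
    falling-tag rewrite splitAt-↑ʳ k (k + k) (k ↑ʳ fromℕ< j<k) | splitAt-↑ʳ k k (fromℕ< j<k)
      = cong (λ z → 2 + z * 3) (toℕ-fromℕ< j<k)
  ... | suc (suc (suc _)) , _ , s≤s (s≤s (s≤s ())) , _

  labelling : Labelling (triSnake (suc k)) s 1
  labelling = record
    { ψ = ψ ; ψ-inj = ψ-inj ; ψ-lo = ψ-lo
    ; ψ-hi = λ w → subst (λ n → ψ w ≤ suc n + s) (sym (edges k)) (ψ-hi w)
    ; edges = edgeLabelling ψ s (k * 3) (edges k) tags onto }
    where
    edges : ∀ k → k + (k + k) ≡ k * 3
    edges = solve-∀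

-- Quadrilateral snakes
--
-- In Q_{k+1}, u_j, v_j, w_j get 4j + s + 1, 4j + s + 2, 4j + s + 3.  With
-- m = 4j + s + 1 the square u_j v_j w_j u_{j+1} has products m(m + 4), m(m + 1),
-- (m + 1)(m + 2) and (m + 2)(m + 4), admitting m + 2, m, m + 1 and m + 3: the tags
-- 4j + 2, 4j, 4j + 1, 4j + 3.
module QuadrilateralSnakeLabelling (k s : ℕ) where
  pathLabel : Fin (suc k) → ℕ
  pathLabel u = classLabel 4 s 0 (toℕ u)

  vLabel : Fin k → ℕ
  vLabel v = classLabel 4 s 1 (toℕ v)

  wLabel : Fin k → ℕ
  wLabel w = classLabel 4 s 2 (toℕ w)

  cornerLabel : Fin (k + k) → ℕ
  cornerLabel = copair vLabel wLabel

  ψ : Fin (suc k + (k + k)) → ℕ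
  ψ = copair pathLabel cornerLabel

  ψ-inj : Injective _≡_ _≡_ ψ
  ψ-inj = copair-injective pathLabel cornerLabel (class-injective 4 s 0<4) corner-inj path≢corner
    where
    0<4 : 0 < 4
    0<4 = s≤s z≤n
    1<4 : 1 < 4
    1<4 = s≤s (s≤s z≤n)
    2<4 : 2 < 4
    2<4 = s≤s (s≤s (s≤s z≤n))
    corner-inj : Injective _≡_ _≡_ cornerLabel
    corner-inj = copair-injective vLabel wLabel (class-injective 4 s 1<4) (class-injective 4 s 2<4)
                                  (classes-disjoint 4 s 1<4 2<4 (λ ()))
    path≢corner : ∀ u c → pathLabel u ≢ cornerLabel c
    path≢corner u = copair-all (pathLabel u ≢_) vLabel wLabel
                               (classes-disjoint 4 s 0<4 1<4 (λ ()) u) (classes-disjoint 4 s 0<4 2<4 (λ ()) u)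

  ψ-lo : ∀ x → s < ψ x
  ψ-lo = copair-all (s <_) pathLabel cornerLabel (λ u → classLabel-lo 4 s 0 (toℕ u))
           (copair-all (s <_) vLabel wLabel (λ v → classLabel-lo 4 s 1 (toℕ v)) (λ w → classLabel-lo 4 s 2 (toℕ w)))

  ψ-hi : ∀ x → ψ x ≤ suc (k * 4) + s
  ψ-hi = copair-all (_≤ suc (k * 4) + s) pathLabel cornerLabel
           (λ u → classLabel-hi 4 s 0 (toℕ u) (s≤s (*-monoˡ-≤ 4 (s≤s⁻¹ (toℕ<n u)))))
           (copair-all (_≤ suc (k * 4) + s) vLabel wLabel
             (λ v → classLabel-hi 4 s 1 (toℕ v) (m≤n⇒m≤1+n (residue< (s≤s (s≤s z≤n)) (toℕ<n v))))
             (λ w → classLabel-hi 4 s 2 (toℕ w) (m≤n⇒m≤1+n (residue< (s≤s (s≤s (s≤s z≤n))) (toℕ<n w)))))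

  ψU : ∀ u → ψ (u ↑ˡ (k + k)) ≡ pathLabel u
  ψU = copair-↑ˡ pathLabel cornerLabel

  ψV : ∀ v → ψ (suc k ↑ʳ (v ↑ˡ k)) ≡ vLabel v
  ψV v = trans (copair-↑ʳ pathLabel cornerLabel (v ↑ˡ k)) (copair-↑ˡ vLabel wLabel v)

  ψW : ∀ w → ψ (suc k ↑ʳ (k ↑ʳ w)) ≡ wLabel w
  ψW w = trans (copair-↑ʳ pathLabel cornerLabel (k ↑ʳ w)) (copair-↑ʳ vLabel wLabel w)

  path-edge : ∀ (j : Fin k) → FloorOrCeilSqrt (ψ (inject₁ j ↑ˡ (k + k)) * ψ (suc j ↑ˡ (k + k))) (suc ((2 + toℕ j * 4) + s))
  path-edge j rewrite ψU (inject₁ j) | ψU (suc j) | toℕ-inject₁ j = between⇒ceil (between-m[m+4] (toℕ j * 4 + s))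

  uv-edge : ∀ (j : Fin k) → FloorOrCeilSqrt (ψ (inject₁ j ↑ˡ (k + k)) * ψ (suc k ↑ʳ (j ↑ˡ k))) (suc (toℕ j * 4 + s))
  uv-edge j rewrite ψU (inject₁ j) | ψV j | toℕ-inject₁ j = between⇒floor (between-m[m+1] (toℕ j * 4 + s))

  vw-edge : ∀ (j : Fin k) → FloorOrCeilSqrt (ψ (suc k ↑ʳ (j ↑ˡ k)) * ψ (suc k ↑ʳ (k ↑ʳ j))) (suc ((1 + toℕ j * 4) + s))
  vw-edge j rewrite ψV j | ψW j = between⇒floor (between-m[m+1] (suc (toℕ j * 4 + s)))

  wu-edge : ∀ (j : Fin k) → FloorOrCeilSqrt (ψ (suc k ↑ʳ (k ↑ʳ j)) * ψ (suc j ↑ˡ (k + k))) (suc ((3 + toℕ j * 4) + s))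
  wu-edge j rewrite ψW j | ψU (suc j) = between⇒ceil (between-m[m+2] (suc (suc (toℕ j * 4 + s))))

  tags : ∀ i → TaggedEdge s (k * 4) (product (quadSnake (suc k)) ψ i)
  tags i with splitAt k i
  ... | inj₁ j = tagged (2 + toℕ j * 4) (residue< (s≤s (s≤s (s≤s z≤n))) (toℕ<n j)) (path-edge j)
  ... | inj₂ j with splitAt k j
  ...   | inj₁ l = tagged (toℕ l * 4) (residue< (s≤s z≤n) (toℕ<n l)) (uv-edge l)
  ...   | inj₂ l with splitAt k l
  ...     | inj₁ r = tagged (1 + toℕ r * 4) (residue< (s≤s (s≤s z≤n)) (toℕ<n r)) (vw-edge r)
  ...     | inj₂ r = tagged (3 + toℕ r * 4) (residue< (s≤s (s≤s (s≤s (s≤s z≤n)))) (toℕ<n r)) (wu-edge r)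

  onto : ∀ t → t < k * 4 → ∃ λ i → TaggedEdge.tag (tags i) ≡ t
  onto t t<4k with residue-decomposition 4 {k} t<4k
  ... | 0 , j , _ , j<k , refl = k ↑ʳ (fromℕ< j<k ↑ˡ (k + k)) , uv-tag
    where
    uv-tag : TaggedEdge.tag (tags (k ↑ʳ (fromℕ< j<k ↑ˡ (k + k)))) ≡ j * 4
    uv-tag rewrite splitAt-↑ʳ k (k + (k + k)) (fromℕ< j<k ↑ˡ (k + k)) | splitAt-↑ˡ k (fromℕ< j<k) (k + k)
      = cong (_* 4) (toℕ-fromℕ< j<k)
  ... | 1 , j , _ , j<k , refl = k ↑ʳ (k ↑ʳ (fromℕ< j<k ↑ˡ k)) , vw-tag
    where
    vw-tag : TaggedEdge.tag (tags (k ↑ʳ (k ↑ʳ (fromℕ< j<k ↑ˡ k)))) ≡ 1 + j * 4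
    vw-tag rewrite splitAt-↑ʳ k (k + (k + k)) (k ↑ʳ (fromℕ< j<k ↑ˡ k)) | splitAt-↑ʳ k (k + k) (fromℕ< j<k ↑ˡ k)
                 | splitAt-↑ˡ k (fromℕ< j<k) k
      = cong (λ z → 1 + z * 4) (toℕ-fromℕ< j<k)
  ... | 2 , j , _ , j<k , refl = fromℕ< j<k ↑ˡ (k + (k + k)) , path-tag
    where
    path-tag : TaggedEdge.tag (tags (fromℕ< j<k ↑ˡ (k + (k + k)))) ≡ 2 + j * 4
    path-tag rewrite splitAt-↑ˡ k (fromℕ< j<k) (k + (k + k)) = cong (λ z → 2 + z * 4) (toℕ-fromℕ< j<k)
  ... | 3 , j , _ , j<k , refl = k ↑ʳ (k ↑ʳ (k ↑ʳ fromℕ< j<k)) , wu-tag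
    where
    wu-tag : TaggedEdge.tag (tags (k ↑ʳ (k ↑ʳ (k ↑ʳ fromℕ< j<k)))) ≡ 3 + j * 4
    wu-tag rewrite splitAt-↑ʳ k (k + (k + k)) (k ↑ʳ (k ↑ʳ fromℕ< j<k)) | splitAt-↑ʳ k (k + k) (k ↑ʳ fromℕ< j<k)
                 | splitAt-↑ʳ k k (fromℕ< j<k)
      = cong (λ z → 3 + z * 4) (toℕ-fromℕ< j<k)
  ... | suc (suc (suc (suc _))) , _ , s≤s (s≤s (s≤s (s≤s ()))) , _

  labelling : Labelling (quadSnake (suc k)) s 1
  labelling = record
    { ψ = ψ ; ψ-inj = ψ-inj ; ψ-lo = ψ-lo
    ; ψ-hi = λ x → subst (λ n → ψ x ≤ suc n + s) (sym (edges k)) (ψ-hi x)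
    ; edges = edgeLabelling ψ s (k * 4) (edges k) tags onto }
    where
    edges : ∀ k → k + (k + (k + k)) ≡ k * 4
    edges = solve-∀

-- Cycles and crowns (on at least two cycle vertices) use only labels up to
-- q + s, so further components can be stacked on top of them; the optional
-- extra component comes last and uses the one spare label q + s + 1.

baseLabelling : ∀ b → 3 ≤ baseSize b → ∀ s → Labelling (baseGraph b) s 0
baseLabelling (cycleB (suc k)) (s≤s 2≤k) s = CycleLabelling.labelling k s (≤-trans (s≤s z≤n) 2≤k)
baseLabelling (crownB (suc k)) (s≤s 2≤k) s = CrownLabelling.labelling k s (≤-trans (s≤s z≤n) 2≤k)

extraLabelling : ∀ e → ExtraOK e → ∀ s → Labelling (extraGraph e) s 1
extraLabelling (pathE (suc n)) _ s = PathLabelling.labelling n s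
extraLabelling (combE (suc k)) _ s = CombLabelling.labelling k s
extraLabelling (triE (suc k))  _ s = TriangularSnakeLabelling.labelling k s
extraLabelling (quadE (suc k)) _ s = QuadrilateralSnakeLabelling.labelling k s

maybeExtraLabelling : ∀ me → MaybeExtraOK me → ∀ s → Labelling (maybeExtraGraph me) s 1
maybeExtraLabelling nothing  _  s = emptyLabelling s 1
maybeExtraLabelling (just e) ok s = extraLabelling e ok s

assembleLabelling : ∀ bs → All (λ b → 3 ≤ baseSize b) bs → ∀ me → MaybeExtraOK me → ∀ s →
                    Labelling (assemble bs me) s 1
assembleLabelling []       []       me ok s = maybeExtraLabelling me ok s
assembleLabelling (b ∷ bs) (h ∷ hs) me ok s =
  DisjointUnion.labelling (baseLabelling b h s) (assembleLabelling bs hs me ok (q (baseGraph b) + s))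

mainTheorem10 : (bs : List Base) → All (λ b → 3 ≤ baseSize b) bs →
                (me : Maybe Extra) → MaybeExtraOK me →
                IsGeometricMean (assemble bs me)
mainTheorem10 bs hs me ok = toGeometricMean (assembleLabelling bs hs me ok 0)
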